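{- Let $h(k)=1$ for all $k\ge1$. Let $n$ and $m$ be positive integers and let $\mu$ be a partition of $m$. Then $$\mathcal{H}(\mu,n)=\frac{\ell(\mu)!}{\prod_{j=1}^{m}\mathfrak{m}_j(\mu)!}\binom{n-|\mu|}{\ell(\mu)}.$$
   Context: With $h\equiv1$ on $\mathbb{N}$, $h(0):=0$, $h_r(n):=\prod_{k=0}^{r-1}h(n-k)$. A composition is a finite sequence of positive integers $\mu=(\mu_1,\dots,\mu_r)$ with $\ell(\mu)=r$, $|\mu|=\sum\mu_i$; $\varepsilon$ is the empty composition. A partition is a non-increasing composition; $\mathfrak{m}_j(\mu)=|\{i:\mu_i=j\}|$. $H(\mu,n)$ is defined by induction on length: $H(\varepsilon,n):=1$; for $\mu=(\mu_1,\dots,\mu_{r+1})$ and $n\ge|\mu|+\ell(\mu)$, $H(\mu,n):=\sum_{k=|\mu|+\ell(\mu)-1}^{n-1}h_{\mu_{r+1}}(k)H((\mu_1,\dots,\mu_r),k-\mu_{r+1})$; $H(\mu,n):=0$ if $n<|\mu|+\ell(\mu)$. $\mathrm{Orb}(\mu)$ is the set of distinct compositions obtained by permuting the parts of $\mu$, and $\mathcal{H}(\mu,n):=\sum_{\lambda\in\mathrm{Orb}(\mu)}H(\lambda,n)$. Binomial coefficients $\binom{a}{b}$ with integer $a$ and integer $b\ge0$ are $0$ when $a<b$. -}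

module Defs where

open import Data.Nat using (ℕ; zero; suc; _+_; _*_; _∸_; _≤_; _<_; _≤ᵇ_)
open import Data.Nat.Combinatorics using (_C_)
open import Data.Bool using (if_then_else_)
open import Data.Nat.ListAction using (sum; product)
open import Data.List using (List; []; _∷_; map; upTo; length; reverse)
open import Data.List.Relation.Unary.All using (All)
open import Data.List.Relation.Unary.Linked using (Linked)
open import Relation.Binary.PropositionalEquality using (_≡_)
open import Data.Nat using (_≟_)
open import Relation.Nullary.Decidable using (does)

h : ℕ → ℕ
h zero    = 0
h (suc _) = 1

hr : ℕ → ℕ → ℕ
hr zero    n = 1
hr (suc r) n = hr r n * h (n ∸ r)

range : ℕ → ℕ → List ℕ
range a b = map (a +_) (upTo (b ∸ a))

-- H on a REVERSED composition: the head is the last part μ_{r+1}.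
-- For ν = (μ_{r+1} ∷ rest), |μ| + ℓ(μ) - 1 = μ_{r+1} + sum rest + length rest,
-- and the summation range k ∈ [|μ|+ℓ(μ)-1, n-1] is empty exactly when n < |μ|+ℓ(μ)
-- (which reproduces the clause H(μ,n) = 0 in that case).
Hrev : List ℕ → ℕ → ℕ
Hrev []         n = 1
Hrev (p ∷ rest) n =
  sum (map (λ k → hr p k * Hrev rest (k ∸ p))
           (range (p + sum rest + length rest) n))

H : List ℕ → ℕ → ℕ
H μ n = Hrev (reverse μ) n

IsComposition : List ℕ → Set
IsComposition μ = All (λ x → 1 ≤ x) μ

_≥ℕ_ : ℕ → ℕ → Set
a ≥ℕ b = b ≤ a

IsPartitionOf : List ℕ → ℕ → Set
IsPartitionOf μ m = IsComposition μ × Linked _≥ℕ_ μ × sum μ ≡ m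
  where open import Data.Product using (_×_)

mult : ℕ → List ℕ → ℕ
mult j []      = 0
mult j (x ∷ μ) = (if does (x ≟ j) then 1 else 0) + mult j μ

_! : ℕ → ℕ
zero  ! = 1
suc n ! = suc n * (n !)

multFactProd : ℕ → List ℕ → ℕ
multFactProd m μ = product (map (λ j → mult j μ !) (range 1 (suc m)))

-- binomial (a - s choose l) with a - s an integer: 0 when a - s < 0 (then a - s < l)
binomDiff : ℕ → ℕ → ℕ → ℕ
binomDiff a s l = if s ≤ᵇ a then (a ∸ s) C l else 0

-- Since h ≡ 1, every factor h_{μ_{r+1}}(k) in the recursion for H is 1, so H(λ, n) is an
-- iterated sum of binomial coefficients; the hockey-stick identity
-- Σ_{i<d} C(L+i, L) = C(L+d, L+1) collapses it to H(λ, n) = C(n − |λ|, ℓ(λ)), which depends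
-- only on the multiset of parts. Hence 𝓗(μ, n) = |Orb(μ)| · C(n − |μ|, ℓ(μ)), and it remains
-- to count the orbit. Enumerating rearrangements by their first part v and recursing on μ
-- with one v removed, 𝔪_v(μ) · ∏_j 𝔪_j(μ∖v)! = ∏_j 𝔪_j(μ)! shows
-- |Orb(μ)| · ∏_j 𝔪_j(μ)! = Σ_v 𝔪_v(μ) · (ℓ(μ) − 1)! = ℓ(μ)!. Any duplicate-free list of the
-- rearrangements is a permutation of this enumeration.
module Submission where

open import Defs
open import Algebra.Properties.CommutativeSemigroup using (x∙yz≈y∙xz; xy∙z≈xz∙y)
open import Data.Bool using (true; false; T; if_then_else_)
open import Data.List using (List; []; _∷_; [_]; _∷ʳ_; map; length; upTo; applyUpTo; reverse; concatMap; deduplicate)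
open import Data.List.Properties
  using (map-∘; map-cong; map-cong-local; map-upTo; applyUpTo-∷ʳ; length-map; length-++; ∷-injectiveʳ)
open import Data.List.Membership.Propositional using (_∈_; find; lose)
open import Data.List.Membership.Propositional.Properties
  using (∈-map⁺; ∈-map⁻; ∈-upTo⁺; ∈-concatMap⁺; ∈-concatMap⁻; ∈-deduplicate⁻; ∈-deduplicate⁺)
open import Data.List.Membership.Propositional.Properties.WithK using (unique∧set⇒bag)
open import Data.List.Relation.Binary.BagAndSetEquality using (∼bag⇒↭)
open import Data.List.Relation.Binary.Permutation.Propositional using (_↭_; ↭-refl; ↭-prep; ↭-swap; ↭-trans; ↭-sym)
open import Data.List.Relation.Binary.Permutation.Propositional.Properties
  using (↭-length; ↭-reverse; ↭-empty-inv; ∈-resp-↭; All-resp-↭; drop-∷; map⁺)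
open import Data.List.Relation.Unary.All as All using (All; []; _∷_)
open import Data.List.Relation.Unary.AllPairs using ([]; _∷_)
open import Data.List.Relation.Unary.Any using (here; there)
open import Data.List.Relation.Unary.Unique.Propositional using (Unique)
open import Data.List.Relation.Unary.Unique.Propositional.Properties using (++⁺; upTo⁺) renaming (map⁺ to Unique-map⁺)
open import Data.List.Relation.Unary.Unique.DecPropositional.Properties using (deduplicate-!)
open import Data.Nat using (ℕ; zero; suc; _+_; _*_; _∸_; _≤_; _<_; _≤ᵇ_; _≟_; s≤s)
open import Data.Nat.Combinatorics using (_C_; nCk+nC[k+1]≡[n+1]C[k+1])
open import Data.Nat.Combinatorics.Specification using (k>n⇒nCk≡0)
open import Data.Nat.ListAction using (sum; product)
open import Data.Nat.ListAction.Properties using (sum-++; sum-↭)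
open import Data.Nat.Properties
  using ( _≤?_; ≤-reflexive; ≤-trans; <⇒≤; ≰⇒>; ≤⇒≤ᵇ; m≤n⇒m≤1+n; m≤m+n; m≤n+m; m≤n+o⇒m∸n≤o
        ; +-identityʳ; +-comm; +-assoc; +-suc; *-identityˡ; *-zeroʳ; *-assoc; *-distribʳ-+
        ; +-∸-assoc; ∸-+-assoc; m+n∸m≡n; m+[n∸m]≡n; m≤n⇒m∸n≡0; suc-injective; 0≢1+n
        ; *-commutativeSemigroup )
open import Data.Product using (_,_; _×_)
open import Function.Base using (_∘′_)
open import Function.Bundles using (_⇔_; mk⇔; Equivalence)
import Function.Properties.Equivalence as ⇔
open import Relation.Binary.PropositionalEquality using (_≡_; _≢_; refl; sym; trans; cong; cong₂; subst; module ≡-Reasoning)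
open import Relation.Nullary using (¬_; yes; no; contradiction)
open import Relation.Nullary.Decidable using (does; dec-true; dec-false)

length-concatMap : ∀ {A B : Set} (f : A → List B) xs → length (concatMap f xs) ≡ sum (map (λ x → length (f x)) xs)
length-concatMap f []       = refl
length-concatMap f (x ∷ xs) = trans (length-++ (f x)) (cong (length (f x) +_) (length-concatMap f xs))

sum-map-*ʳ : ∀ {A : Set} (f : A → ℕ) c xs → sum (map f xs) * c ≡ sum (map (λ x → f x * c) xs)
sum-map-*ʳ f c []       = refl
sum-map-*ʳ f c (x ∷ xs) = trans (*-distribʳ-+ c (f x) _) (cong (f x * c +_) (sum-map-*ʳ f c xs))

sum-map-const : ∀ {A : Set} {f : A → ℕ} {c} xs → (∀ {x} → x ∈ xs → f x ≡ c) → sum (map f xs) ≡ length xs * c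
sum-map-const []       f≡c = refl
sum-map-const (x ∷ xs) f≡c = cong₂ _+_ (f≡c (here refl)) (sum-map-const xs (f≡c ∘′ there))

∈⇒≤sum : ∀ {x xs} → x ∈ xs → x ≤ sum xs
∈⇒≤sum {xs = y ∷ xs} (here refl)  = m≤m+n y (sum xs)
∈⇒≤sum {xs = y ∷ xs} (there x∈xs) = ≤-trans (∈⇒≤sum x∈xs) (m≤n+m (sum xs) y)

Unique-concatMap-∷ : ∀ {A : Set} (g : A → List (List A)) {U} → Unique U → (∀ v → Unique (g v)) →
                     Unique (concatMap (λ v → map (v ∷_) (g v)) U)
Unique-concatMap-∷ g {[]}    []         g! = []
Unique-concatMap-∷ g {u ∷ U} (u∉U ∷ U!) g! =
  ++⁺ (Unique-map⁺ ∷-injectiveʳ (g! u)) (Unique-concatMap-∷ g U! g!) disjoint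
  where
  disjoint : ∀ {z} → ¬ (z ∈ map (u ∷_) (g u) × z ∈ concatMap (λ v → map (v ∷_) (g v)) U)
  disjoint (z∈u , z∈U)
    with _ , _ , refl ← ∈-map⁻ (u ∷_) z∈u
    with w , w∈U , z∈w ← find (∈-concatMap⁻ _ z∈U)
    with _ , _ , refl ← ∈-map⁻ (w ∷_) z∈w
    = All.lookup u∉U w∈U refl

hr≡1 : ∀ p k → p ≤ k → hr p k ≡ 1
hr≡1 zero    k       _         = refl
hr≡1 (suc p) (suc k) (s≤s p≤k) rewrite hr≡1 p (suc k) (m≤n⇒m≤1+n p≤k) | +-∸-assoc 1 p≤k = refl

sum-applyUpTo-C : ∀ L d → sum (applyUpTo (λ i → (L + i) C L) d) ≡ (L + d) C suc L
sum-applyUpTo-C L zero = sym (k>n⇒nCk≡0 (s≤s (≤-reflexive (+-identityʳ L))))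
sum-applyUpTo-C L (suc d) = begin
  sum (applyUpTo f (suc d))          ≡⟨ cong sum (applyUpTo-∷ʳ f d) ⟨
  sum (applyUpTo f d ∷ʳ f d)         ≡⟨ sum-++ (applyUpTo f d) (f d ∷ []) ⟩
  sum (applyUpTo f d) + (f d + 0)    ≡⟨ cong₂ _+_ (sum-applyUpTo-C L d) (+-identityʳ (f d)) ⟩
  (L + d) C suc L + (L + d) C L      ≡⟨ +-comm ((L + d) C suc L) _ ⟩
  (L + d) C L + (L + d) C suc L      ≡⟨ nCk+nC[k+1]≡[n+1]C[k+1] (L + d) L ⟩
  suc (L + d) C suc L                ≡⟨ cong (_C suc L) (+-suc L d) ⟨
  (L + suc d) C suc L                ∎
  where
  open ≡-Reasoning
  f : ℕ → ℕ
  f i = (L + i) C L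

C-∸-shift : ∀ c L n → (L + (n ∸ (c + L))) C suc L ≡ (n ∸ c) C suc L
C-∸-shift c L n with c + L ≤? n
... | yes c+L≤n = cong (_C suc L) (begin
  L + (n ∸ (c + L))           ≡⟨ m+n∸m≡n c _ ⟨
  c + (L + (n ∸ (c + L))) ∸ c ≡⟨ cong (_∸ c) (+-assoc c L _) ⟨
  c + L + (n ∸ (c + L)) ∸ c   ≡⟨ cong (_∸ c) (m+[n∸m]≡n c+L≤n) ⟩
  n ∸ c                       ∎)
  where open ≡-Reasoning
... | no c+L≰n = begin
  (L + (n ∸ (c + L))) C suc L ≡⟨ cong (λ x → (L + x) C suc L) (m≤n⇒m∸n≡0 n≤c+L) ⟩
  (L + 0) C suc L             ≡⟨ k>n⇒nCk≡0 (s≤s (≤-reflexive (+-identityʳ L))) ⟩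
  0                           ≡⟨ k>n⇒nCk≡0 (s≤s (m≤n+o⇒m∸n≤o n c n≤c+L)) ⟨
  (n ∸ c) C suc L             ∎
  where
  open ≡-Reasoning
  n≤c+L : n ≤ c + L
  n≤c+L = <⇒≤ (≰⇒> c+L≰n)

Hrev≡C : ∀ ν n → Hrev ν n ≡ (n ∸ sum ν) C length ν
Hrev≡C []      n = refl
Hrev≡C (p ∷ ν) n = begin
  sum (map g (range a n))                            ≡⟨ cong sum (map-∘ (upTo (n ∸ a))) ⟨
  sum (map (λ i → g (a + i)) (upTo (n ∸ a)))         ≡⟨ cong sum (map-cong summand (upTo (n ∸ a))) ⟩
  sum (map (λ i → (L + i) C L) (upTo (n ∸ a)))       ≡⟨ cong sum (map-upTo _ (n ∸ a)) ⟩
  sum (applyUpTo (λ i → (L + i) C L) (n ∸ a))        ≡⟨ sum-applyUpTo-C L (n ∸ a) ⟩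
  (L + (n ∸ (p + S + L))) C suc L                    ≡⟨ C-∸-shift (p + S) L n ⟩
  (n ∸ (p + S)) C suc L                              ∎
  where
  open ≡-Reasoning
  S = sum ν
  L = length ν
  a = p + S + L
  g : ℕ → ℕ
  g k = hr p k * Hrev ν (k ∸ p)
  shifted : ∀ i → a + i ∸ p ∸ S ≡ L + i
  shifted i = begin
    a + i ∸ p ∸ S         ≡⟨ ∸-+-assoc (a + i) p S ⟩
    a + i ∸ (p + S)       ≡⟨ cong (_∸ (p + S)) (+-assoc (p + S) L i) ⟩
    p + S + (L + i) ∸ (p + S) ≡⟨ m+n∸m≡n (p + S) (L + i) ⟩
    L + i                 ∎
  summand : ∀ i → g (a + i) ≡ (L + i) C L
  summand i = begin
    hr p (a + i) * Hrev ν (a + i ∸ p)  ≡⟨ cong₂ _*_ (hr≡1 p (a + i) p≤a+i) (Hrev≡C ν (a + i ∸ p)) ⟩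
    1 * ((a + i ∸ p ∸ S) C L)          ≡⟨ *-identityˡ _ ⟩
    (a + i ∸ p ∸ S) C L                ≡⟨ cong (_C L) (shifted i) ⟩
    (L + i) C L                        ∎
    where
    p≤a+i : p ≤ a + i
    p≤a+i = ≤-trans (≤-trans (m≤m+n p S) (m≤m+n (p + S) L)) (m≤m+n a i)

binomDiff≡∸C : ∀ a ν → binomDiff a (sum ν) (length ν) ≡ (a ∸ sum ν) C length ν
binomDiff≡∸C a []      = refl
binomDiff≡∸C a (p ∷ ν) with p + sum ν ≤ᵇ a in eq
... | true  = refl
... | false = sym (k>n⇒nCk≡0 (s≤s (m≤n+o⇒m∸n≤o a (p + sum ν) (≤-trans (<⇒≤ a<s) (m≤m+n _ (length ν))))))
  where
  a<s : a < p + sum ν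
  a<s = ≰⇒> (λ s≤a → subst T eq (≤⇒≤ᵇ s≤a))

H-↭ : ∀ {λ′ μ} n → λ′ ↭ μ → H λ′ n ≡ binomDiff n (sum μ) (length μ)
H-↭ {λ′} {μ} n λ′↭μ = begin
  Hrev (reverse λ′) n                              ≡⟨ Hrev≡C (reverse λ′) n ⟩
  (n ∸ sum (reverse λ′)) C length (reverse λ′)    ≡⟨ cong₂ (λ s l → (n ∸ s) C l) (sum-↭ rev) (↭-length rev) ⟩
  (n ∸ sum μ) C length μ                          ≡⟨ binomDiff≡∸C n μ ⟨
  binomDiff n (sum μ) (length μ)                  ∎
  where
  open ≡-Reasoning
  rev : reverse λ′ ↭ μ
  rev = ↭-trans (↭-reverse λ′) λ′↭μ

mult-∷-≡ : ∀ v μ → mult v (v ∷ μ) ≡ suc (mult v μ)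
mult-∷-≡ v μ rewrite dec-true (v ≟ v) refl = refl

mult-∷-≢ : ∀ {x j} μ → x ≢ j → mult j (x ∷ μ) ≡ mult j μ
mult-∷-≢ {x} {j} μ x≢j rewrite dec-false (x ≟ j) x≢j = refl

mult≡sum : ∀ j μ → mult j μ ≡ sum (map (λ x → if does (x ≟ j) then 1 else 0) μ)
mult≡sum j []      = refl
mult≡sum j (x ∷ μ) = cong (_ +_) (mult≡sum j μ)

mult-↭ : ∀ j {μ ν} → μ ↭ ν → mult j μ ≡ mult j ν
mult-↭ j {μ} {ν} μ↭ν = trans (mult≡sum j μ) (trans (sum-↭ (map⁺ _ μ↭ν)) (sym (mult≡sum j ν)))

sum-mult-∷ : ∀ {U x} μ → Unique U → x ∈ U →
             sum (map (λ v → mult v (x ∷ μ)) U) ≡ suc (sum (map (λ v → mult v μ) U))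
sum-mult-∷ {x ∷ U} μ (x∉U ∷ _) (here refl) =
  cong₂ _+_ (mult-∷-≡ x μ) (cong sum (map-cong-local (All.map (mult-∷-≢ μ) x∉U)))
sum-mult-∷ {u ∷ U} {x} μ (u∉U ∷ U!) (there x∈U) =
  trans (cong₂ _+_ (mult-∷-≢ μ (λ x≡u → All.lookup u∉U x∈U (sym x≡u))) (sum-mult-∷ μ U! x∈U))
        (+-suc (mult u μ) _)

sum-mult : ∀ {U} μ → Unique U → All (_∈ U) μ → sum (map (λ v → mult v μ) U) ≡ length μ
sum-mult {U} []      _  _           = trans (sum-map-const U (λ _ → refl)) (*-zeroʳ (length U))
sum-mult     (x ∷ μ) U! (x∈U ∷ μ⊆U) = trans (sum-mult-∷ μ U! x∈U) (cong suc (sum-mult μ U! μ⊆U))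

multFactProdOver : List ℕ → List ℕ → ℕ
multFactProdOver D μ = product (map (λ j → mult j μ !) D)

multFactProdOver-[] : ∀ D → multFactProdOver D [] ≡ 1
multFactProdOver-[] []      = refl
multFactProdOver-[] (_ ∷ D) = trans (*-identityˡ _) (multFactProdOver-[] D)

multFactProdOver-∷ : ∀ {D v} μ → Unique D → v ∈ D →
                     multFactProdOver D (v ∷ μ) ≡ suc (mult v μ) * multFactProdOver D μ
multFactProdOver-∷ {v ∷ D} μ (v∉D ∷ _) (here refl) = begin
  mult v (v ∷ μ) ! * Q (v ∷ μ)         ≡⟨ cong₂ (λ k rest → k ! * rest) (mult-∷-≡ v μ) (cong product others) ⟩
  suc m * m ! * Q μ                    ≡⟨ *-assoc (suc m) (m !) (Q μ) ⟩
  suc m * (m ! * Q μ)                  ∎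
  where
  open ≡-Reasoning
  Q = multFactProdOver D
  m = mult v μ
  others : map (λ j → mult j (v ∷ μ) !) D ≡ map (λ j → mult j μ !) D
  others = map-cong-local (All.map (λ v≢j → cong _! (mult-∷-≢ μ v≢j)) v∉D)
multFactProdOver-∷ {u ∷ D} {v} μ (u∉D ∷ D!) (there v∈D) = begin
  mult u (v ∷ μ) ! * Q (v ∷ μ)         ≡⟨ cong₂ (λ k rest → k ! * rest) (mult-∷-≢ μ v≢u) (multFactProdOver-∷ μ D! v∈D) ⟩
  mult u μ ! * (suc m * Q μ)           ≡⟨ x∙yz≈y∙xz *-commutativeSemigroup (mult u μ !) (suc m) (Q μ) ⟩
  suc m * (mult u μ ! * Q μ)           ∎
  where
  open ≡-Reasoning
  Q = multFactProdOver D
  m = mult v μ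
  v≢u : v ≢ u
  v≢u v≡u = All.lookup u∉D v∈D (sym v≡u)

multFactProdOver-↭ : ∀ D {μ ν} → μ ↭ ν → multFactProdOver D μ ≡ multFactProdOver D ν
multFactProdOver-↭ D μ↭ν = cong product (map-cong (λ j → cong _! (mult-↭ j μ↭ν)) D)

removeFirst : ℕ → List ℕ → List ℕ
removeFirst v []      = []
removeFirst v (x ∷ μ) with x ≟ v
... | yes _ = μ
... | no  _ = x ∷ removeFirst v μ

↭-removeFirst : ∀ {v μ} → v ∈ μ → μ ↭ v ∷ removeFirst v μ
↭-removeFirst {v} {x ∷ μ} v∈xμ with x ≟ v | v∈xμ
... | yes refl | _         = ↭-refl
... | no  x≢v  | here v≡x  = contradiction (sym v≡x) x≢v
... | no  x≢v  | there v∈μ = ↭-trans (↭-prep x (↭-removeFirst v∈μ)) (↭-swap x v ↭-refl)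

length-removeFirst : ∀ {v μ f} → v ∈ μ → length μ ≡ suc f → length (removeFirst v μ) ≡ f
length-removeFirst v∈μ |μ|≡1+f = suc-injective (trans (sym (↭-length (↭-removeFirst v∈μ))) |μ|≡1+f)

multFactProdOver-removeFirst : ∀ {D v μ} → Unique D → v ∈ D → v ∈ μ →
  multFactProdOver D μ ≡ mult v μ * multFactProdOver D (removeFirst v μ)
multFactProdOver-removeFirst {D} {v} {μ} D! v∈D v∈μ = begin
  multFactProdOver D μ                            ≡⟨ multFactProdOver-↭ D μ↭ ⟩
  multFactProdOver D (v ∷ μ′)                     ≡⟨ multFactProdOver-∷ μ′ D! v∈D ⟩
  suc (mult v μ′) * multFactProdOver D μ′         ≡⟨ cong (_* multFactProdOver D μ′) (sym mult-v) ⟩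
  mult v μ * multFactProdOver D μ′                ∎
  where
  open ≡-Reasoning
  μ′ = removeFirst v μ
  μ↭ : μ ↭ v ∷ μ′
  μ↭ = ↭-removeFirst v∈μ
  mult-v : mult v μ ≡ suc (mult v μ′)
  mult-v = trans (mult-↭ v μ↭) (mult-∷-≡ v μ′)

-- The fuel f is the length of μ; any other value gives a meaningless list.
arrangements : ℕ → List ℕ → List (List ℕ)
arrangements zero    μ = [ [] ]
arrangements (suc f) μ =
  concatMap (λ v → map (v ∷_) (arrangements f (removeFirst v μ))) (deduplicate _≟_ μ)

arrangements-unique : ∀ f μ → Unique (arrangements f μ)
arrangements-unique zero    μ = [] ∷ []
arrangements-unique (suc f) μ =
  Unique-concatMap-∷ (λ v → arrangements f (removeFirst v μ)) (deduplicate-! _≟_ μ)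
    (λ v → arrangements-unique f (removeFirst v μ))

∈-arrangements : ∀ f μ → length μ ≡ f → ∀ ν → (ν ∈ arrangements f μ) ⇔ (ν ↭ μ)
∈-arrangements zero    [] _ ν = mk⇔ (λ { (here refl) → ↭-refl }) (λ ν↭[] → here (↭-empty-inv ν↭[]))
∈-arrangements (suc f) μ |μ|≡1+f ν = mk⇔ to (from ν)
  where
  prefixed : ℕ → List (List ℕ)
  prefixed v = map (v ∷_) (arrangements f (removeFirst v μ))
  IH : ∀ {v} → v ∈ μ → ∀ ν′ → (ν′ ∈ arrangements f (removeFirst v μ)) ⇔ (ν′ ↭ removeFirst v μ)
  IH v∈μ = ∈-arrangements f _ (length-removeFirst v∈μ |μ|≡1+f)
  to : ν ∈ arrangements (suc f) μ → ν ↭ μ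
  to ν∈
    with v , v∈dedup , ν∈v ← find (∈-concatMap⁻ prefixed {deduplicate _≟_ μ} ν∈)
    with ν′ , ν′∈ , refl ← ∈-map⁻ (v ∷_) ν∈v
    = let v∈μ = ∈-deduplicate⁻ _≟_ μ v∈dedup in
      ↭-trans (↭-prep v (Equivalence.to (IH v∈μ ν′) ν′∈)) (↭-sym (↭-removeFirst v∈μ))
  from : ∀ ν → ν ↭ μ → ν ∈ arrangements (suc f) μ
  from []       ν↭μ = contradiction (trans (↭-length ν↭μ) |μ|≡1+f) 0≢1+n
  from (v ∷ ν′) ν↭μ =
    ∈-concatMap⁺ prefixed (lose (∈-deduplicate⁺ _≟_ v∈μ) (∈-map⁺ (v ∷_) (Equivalence.from (IH v∈μ ν′) ν′↭)))
    where
    v∈μ : v ∈ μ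
    v∈μ = ∈-resp-↭ ν↭μ (here refl)
    ν′↭ : ν′ ↭ removeFirst v μ
    ν′↭ = drop-∷ (↭-trans ν↭μ (↭-removeFirst v∈μ))

length-arrangements : ∀ {D} f μ → Unique D → All (_∈ D) μ → length μ ≡ f →
                      length (arrangements f μ) * multFactProdOver D μ ≡ f !
length-arrangements {D} zero [] _ _ _ = trans (*-identityˡ _) (multFactProdOver-[] D)
length-arrangements {D} (suc f) μ D! μ⊆D |μ|≡1+f = begin
  length (concatMap prefixed U) * Q μ                ≡⟨ cong (_* Q μ) (length-concatMap prefixed U) ⟩
  sum (map (λ v → length (prefixed v)) U) * Q μ      ≡⟨ sum-map-*ʳ (λ v → length (prefixed v)) (Q μ) U ⟩
  sum (map (λ v → length (prefixed v) * Q μ) U)      ≡⟨ cong sum (map-cong-local (All.tabulate choice)) ⟩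
  sum (map (λ v → mult v μ * f !) U)                 ≡⟨ sum-map-*ʳ (λ v → mult v μ) (f !) U ⟨
  sum (map (λ v → mult v μ) U) * f !                 ≡⟨ cong (_* f !) (trans (sum-mult μ U! μ⊆U) |μ|≡1+f) ⟩
  suc f * f !                                        ∎
  where
  open ≡-Reasoning
  Q = multFactProdOver D
  U = deduplicate _≟_ μ
  U! : Unique U
  U! = deduplicate-! _≟_ μ
  μ⊆U : All (_∈ U) μ
  μ⊆U = All.tabulate (∈-deduplicate⁺ _≟_)
  prefixed : ℕ → List (List ℕ)
  prefixed v = map (v ∷_) (arrangements f (removeFirst v μ))
  choice : ∀ {v} → v ∈ U → length (prefixed v) * Q μ ≡ mult v μ * f !
  choice {v} v∈U = begin
    length (map (v ∷_) A) * Q μ        ≡⟨ cong₂ _*_ (length-map (v ∷_) A) (multFactProdOver-removeFirst D! v∈D v∈μ) ⟩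
    length A * (mult v μ * Q μ′)       ≡⟨ x∙yz≈y∙xz *-commutativeSemigroup (length A) (mult v μ) (Q μ′) ⟩
    mult v μ * (length A * Q μ′)       ≡⟨ cong (mult v μ *_) (length-arrangements f μ′ D! μ′⊆D |μ′|≡f) ⟩
    mult v μ * f !                     ∎
    where
    v∈μ = ∈-deduplicate⁻ _≟_ μ v∈U
    v∈D = All.lookup μ⊆D v∈μ
    μ′ = removeFirst v μ
    A = arrangements f μ′
    μ′⊆D : All (_∈ D) μ′
    μ′⊆D = All.tail (All-resp-↭ (↭-removeFirst v∈μ) μ⊆D)
    |μ′|≡f = length-removeFirst v∈μ |μ|≡1+f

orbit-stabiliser : ∀ {D orb} μ → Unique D → All (_∈ D) μ →
                   Unique orb → (∀ ν → (ν ∈ orb) ⇔ (ν ↭ μ)) →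
                   length orb * multFactProdOver D μ ≡ length μ !
orbit-stabiliser {D} {orb} μ D! μ⊆D orb! orb-orbit = begin
  length orb * multFactProdOver D μ                            ≡⟨ cong (_* multFactProdOver D μ) (↭-length orb↭A) ⟩
  length (arrangements (length μ) μ) * multFactProdOver D μ    ≡⟨ length-arrangements (length μ) μ D! μ⊆D refl ⟩
  length μ !                                                   ∎
  where
  open ≡-Reasoning
  orb↭A : orb ↭ arrangements (length μ) μ
  orb↭A = ∼bag⇒↭ (unique∧set⇒bag orb! (arrangements-unique (length μ) μ)
            (λ {ν} → ⇔.trans (orb-orbit ν) (⇔.sym (∈-arrangements (length μ) μ refl ν))))

parts⊆range : ∀ {μ m} → All (1 ≤_) μ → sum μ ≡ m → All (_∈ range 1 (suc m)) μ
parts⊆range {μ} μ-pos refl = All.tabulate (λ x∈μ → inRange (All.lookup μ-pos x∈μ) (∈⇒≤sum x∈μ))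
  where
  inRange : ∀ {x} → 1 ≤ x → x ≤ sum μ → x ∈ range 1 (suc (sum μ))
  inRange {suc x} _ x<sum = ∈-map⁺ suc (∈-upTo⁺ x<sum)

mainTheorem6 : (n m : ℕ) → 1 ≤ n → 1 ≤ m → (μ : List ℕ) → IsPartitionOf μ m →
    (orb : List (List ℕ)) → Unique orb → (∀ λ′ → (λ′ ∈ orb) ⇔ (λ′ ↭ μ)) →
    sum (map (λ λ′ → H λ′ n) orb) * multFactProd m μ
    ≡ (length μ) ! * binomDiff n (sum μ) (length μ)
mainTheorem6 n m _ _ μ (μ-pos , _ , sum≡m) orb orb! orb-orbit = begin
  sum (map (λ λ′ → H λ′ n) orb) * P  ≡⟨ cong (_* P) (sum-map-const orb (λ {λ′} → H-↭ n ∘′ Equivalence.to (orb-orbit λ′))) ⟩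
  length orb * B * P                 ≡⟨ xy∙z≈xz∙y *-commutativeSemigroup (length orb) B P ⟩
  length orb * P * B                 ≡⟨ cong (_* B) (orbit-stabiliser μ range! (parts⊆range μ-pos sum≡m) orb! orb-orbit) ⟩
  length μ ! * B                     ∎
  where
  open ≡-Reasoning
  P = multFactProd m μ
  B = binomDiff n (sum μ) (length μ)
  range! : Unique (range 1 (suc m))
  range! = Unique-map⁺ suc-injective (upTo⁺ m)
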